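{- Let $n$ be an integer whose binary representation has length $b = O(\log n)$. Then $n!$ can be computed in $O(b^2)$ steps on a real RAM with the rounding operation.
   Context: A real RAM is a word RAM (a random-access machine with an infinite array of word registers holding integers of $\Theta(\log N)$ bits, $N$ the input length, with unit-cost assignment of constants, copying, indirect addressing, integer arithmetic, comparisons and jumps) extended by a second infinite array of registers each holding an exact real number, on which it can perform at unit cost the exact operations $+,-,\times,\div$ and the sign test "is $R>0$?". A real RAM with the rounding operation additionally has, at unit cost, the operation that given a real $x$ returns the unique integer $i$ with $i \le x < i+1$ (i.e. $\lfloor x\rfloor$). A "step" is one unit-cost operation. -}

module Defs where

-- All values a real RAM can produce
-- from integer constants and the input by + - * / and floor are
-- rational, so the real registers are modelled by ℚ.

open import Data.Nat as ℕ using (ℕ; zero; suc; _^_)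
open import Data.Nat.Logarithm using (⌊log₂_⌋)
open import Data.Integer as ℤ using (ℤ; +_; -[1+_]; +[1+_]; ∣_∣)
import Data.Integer.DivMod as ℤDM
open import Data.Rational as ℚ using (ℚ; 0ℚ; floor; ≢-nonZero)
import Data.Rational.Properties as ℚP
open import Data.List using (List; []; _∷_)
open import Data.Maybe using (Maybe; just; nothing; _>>=_)
open import Data.Bool using (Bool; true; false; if_then_else_)
open import Relation.Nullary using (yes; no)
open import Data.Product using (Σ; _×_)
open import Relation.Binary.PropositionalEquality using (_≡_)

-- integer word operations (division = floor division; by 0 is an error)
data WOp : Set where
  wadd wsub wmul wdiv : WOp

data ROp : Set where
  radd rsub rmul rdiv : ROp

data Instr : Set where
  wconst : ℕ → ℤ → Instr               -- W[i] := c
  wcopy  : ℕ → ℕ → Instr               -- W[i] := W[j]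
  wload  : ℕ → ℕ → Instr               -- W[i] := W[W[j]]
  wstore : ℕ → ℕ → Instr               -- W[W[i]] := W[j]
  wop    : WOp → ℕ → ℕ → ℕ → Instr     -- W[i] := W[j] op W[k]
  wjpos  : ℕ → ℕ → Instr               -- if W[i] > 0 then goto l
  jmp    : ℕ → Instr                   -- goto l
  rconst : ℕ → ℤ → Instr               -- R[i] := c
  rcopy  : ℕ → ℕ → Instr               -- R[i] := R[j]
  rload  : ℕ → ℕ → Instr               -- R[i] := R[W[j]]
  rstore : ℕ → ℕ → Instr               -- R[W[i]] := R[j]
  rop    : ROp → ℕ → ℕ → ℕ → Instr     -- R[i] := R[j] op R[k]
  rjpos  : ℕ → ℕ → Instr               -- if R[i] > 0 then goto l
  w2r    : ℕ → ℕ → Instr               -- R[i] := W[j]   (integer as real)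
  rfloor : ℕ → ℕ → Instr               -- R[i] := ⌊ R[j] ⌋  (rounding)
  halt   : Instr

Program : Set
Program = List Instr

record Config : Set where
  constructor cfg
  field
    pc : ℕ
    W  : ℕ → ℤ
    R  : ℕ → ℚ
open Config public

fetch : Program → ℕ → Maybe Instr
fetch []       _       = nothing
fetch (x ∷ xs) zero    = just x
fetch (x ∷ xs) (suc n) = fetch xs n

update : {A : Set} → (ℕ → A) → ℕ → A → ℕ → A
update f i a j with i ℕ.≟ j
... | yes _ = a
... | no  _ = f j

checkWord : ℕ → ℤ → Maybe ℤ
checkWord wb v = if ∣ v ∣ ℕ.<ᵇ 2 ^ wb then just v else nothing

toAddr : ℤ → Maybe ℕ
toAddr (+ n)    = just n
toAddr -[1+ _ ] = nothing

evalW : WOp → ℤ → ℤ → Maybe ℤ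
evalW wadd a b = just (a ℤ.+ b)
evalW wsub a b = just (a ℤ.- b)
evalW wmul a b = just (a ℤ.* b)
evalW wdiv a (+ zero)    = nothing
evalW wdiv a +[1+ n ]    = just (a ℤDM./ +[1+ n ])
evalW wdiv a -[1+ n ]    = just (a ℤDM./ -[1+ n ])

evalR : ROp → ℚ → ℚ → Maybe ℚ
evalR radd a b = just (a ℚ.+ b)
evalR rsub a b = just (a ℚ.- b)
evalR rmul a b = just (a ℚ.* b)
evalR rdiv a b with b ℚP.≟ 0ℚ
... | yes _  = nothing
... | no b≢0 = just (ℚ._÷_ a b {{≢-nonZero b≢0}})

ℤ→ℚ : ℤ → ℚ
ℤ→ℚ z = z ℚ./ 1

-- one step (one unit-cost operation) with word size wb;
-- nothing = error / halted (no further step possible)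
exec : ℕ → Instr → Config → Maybe Config
exec wb (wconst i c) (cfg p w r) =
  checkWord wb c >>= λ v → just (cfg (suc p) (update w i v) r)
exec wb (wcopy i j) (cfg p w r) = just (cfg (suc p) (update w i (w j)) r)
exec wb (wload i j) (cfg p w r) =
  toAddr (w j) >>= λ a → just (cfg (suc p) (update w i (w a)) r)
exec wb (wstore i j) (cfg p w r) =
  toAddr (w i) >>= λ a → just (cfg (suc p) (update w a (w j)) r)
exec wb (wop o i j k) (cfg p w r) =
  evalW o (w j) (w k) >>= λ v → checkWord wb v >>= λ v' →
  just (cfg (suc p) (update w i v') r)
exec wb (wjpos i l) (cfg p w r) =
  just (cfg (if w i ℤ.≤ᵇ ℤ.0ℤ then suc p else l) w r)
exec wb (jmp l) (cfg p w r) = just (cfg l w r)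
exec wb (rconst i c) (cfg p w r) = just (cfg (suc p) w (update r i (ℤ→ℚ c)))
exec wb (rcopy i j) (cfg p w r) = just (cfg (suc p) w (update r i (r j)))
exec wb (rload i j) (cfg p w r) =
  toAddr (w j) >>= λ a → just (cfg (suc p) w (update r i (r a)))
exec wb (rstore i j) (cfg p w r) =
  toAddr (w i) >>= λ a → just (cfg (suc p) w (update r a (r j)))
exec wb (rop o i j k) (cfg p w r) =
  evalR o (r j) (r k) >>= λ v → just (cfg (suc p) w (update r i v))
exec wb (rjpos i l) (cfg p w r) =
  just (cfg (if r i ℚ.≤ᵇ 0ℚ then suc p else l) w r)
exec wb (w2r i j) (cfg p w r) = just (cfg (suc p) w (update r i (ℤ→ℚ (w j))))
exec wb (rfloor i j) (cfg p w r) =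
  just (cfg (suc p) w (update r i (ℤ→ℚ (floor (r j)))))
exec wb halt c = nothing

step : ℕ → Program → Config → Maybe Config
step wb P c = fetch P (pc c) >>= λ ins → exec wb ins c

run : ℕ → Program → ℕ → Config → Maybe Config
run wb P zero    c = just c
run wb P (suc t) c = step wb P c >>= run wb P t

-- length of the binary representation of n (0 is written "0")
bitLen : ℕ → ℕ
bitLen n = suc ⌊log₂ n ⌋

-- word size Θ(log N) for input length N: k * (1 + ⌊log₂ N⌋) bits
wordBits : ℕ → ℕ → ℕ
wordBits k N = k ℕ.* suc ⌊log₂ N ⌋

initConfig : ℕ → Config
initConfig n = cfg 0 (λ _ → ℤ.0ℤ) (λ { zero → ℤ→ℚ (+ n) ; (suc _) → 0ℚ })

HaltsWithOutput : ℕ → Program → Config → ℕ → ℚ → Set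
HaltsWithOutput wb P c t x =
  Σ Config λ c' →
    (run wb P t c ≡ just c') × (fetch P (pc c') ≡ just halt) × (R c' 0 ≡ x)

{-# OPTIONS --safe #-}
module Submission where

-- Let L be the number of binary digits of n and B = 2 ^ 2 ^ L, so that B > 2 ^ n.  For
-- m ≤ n / 2 every binomial coefficient (m + m) C k is at most 2 ^ (m + m) < B, so the
-- base-B digits of (1 + B) ^ (m + m) are exactly these coefficients and
--   (m + m) C m = ⌊ (1 + B) ^ (m + m) / B ^ m ⌋ mod B.
-- Together with (m + m) ! = (m + m) C m * m ! * m ! this turns m ! into (2 m + bit) !
-- with a constant number of real operations, given (1 + B) ^ m and B ^ m.  The program
-- squares B up L times and then runs j from L down to 0, maintaining m = ⌊ n / 2 ^ j ⌋
-- together with m !, (1 + B) ^ m and B ^ m: O(b) steps in all.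

open import Defs
open import Data.Nat
  using (ℕ; zero; suc; _+_; _*_; _∸_; _^_; _≤_; _<_; _≤ᵇ_; _!; pred; NonZero; ≢-nonZero; ≢-nonZero⁻¹; z≤n; s≤s; _<?_)
open import Data.Nat.Properties
open import Data.Nat.DivMod
open import Data.Nat.Divisibility using (n∣m*n)
open import Data.Nat.Combinatorics using (_C_; nCk≡n!/k![n-k]!; k![n∸k]!∣n!; nCk+nC[k+1]≡[n+1]C[k+1])
open import Data.Nat.GCD using (gcd; gcd[m,n]∣m; gcd[m,n]∣n; gcd[m,n]≢0; n/gcd[m,n]≢0)
open import Data.Nat.Coprimality using (Coprime; 1-coprimeTo) renaming (sym to coprime-sym)
open import Data.Nat.Logarithm using (⌊log₂⌋-mono-≤; ⌊log₂[2^n]⌋≡n)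
open import Data.Nat.Tactic.RingSolver using (solve-∀)
open import Data.Integer as ℤ using (ℤ; +_)
import Data.Integer.Properties as ℤ
open import Data.Rational as ℚ using (ℚ; mkℚ; 0ℚ; floor; normalize)
import Data.Rational.Properties as ℚ
open import Data.Bool using (if_then_else_)
open import Data.Maybe using (Maybe; just; nothing; _>>=_)
open import Data.List using (_∷_; [])
open import Data.Product using (∃-syntax; _×_; _,_)
open import Data.Sum using (inj₂)
open import Function using (_∘_)
open import Relation.Nullary using (yes; no)
open import Relation.Nullary.Negation using (contradiction)
open import Relation.Binary.PropositionalEquality

-- Binomial coefficients as base-B digits

nCk≤2^n : ∀ n k → n C k ≤ 2 ^ n
nCk≤2^n n       zero    = m^n>0 2 n
nCk≤2^n zero    (suc k) = z≤n
nCk≤2^n (suc n) (suc k) = begin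
  suc n C suc k     ≡⟨ nCk+nC[k+1]≡[n+1]C[k+1] n k ⟨
  n C k + n C suc k ≤⟨ +-mono-≤ (nCk≤2^n n k) (nCk≤2^n n (suc k)) ⟩
  2 ^ n + 2 ^ n     ≡⟨ cong (_+_ (2 ^ n)) (+-identityʳ (2 ^ n)) ⟨
  2 ^ suc n         ∎
  where open ≤-Reasoning

nCk*[k!*[n∸k]!]≡n! : ∀ {n k} → k ≤ n → (n C k) * (k ! * (n ∸ k) !) ≡ n !
nCk*[k!*[n∸k]!]≡n! {n} {k} k≤n = begin
  (n C k) * (k ! * (n ∸ k) !)                  ≡⟨ cong (_* (k ! * (n ∸ k) !)) (nCk≡n!/k![n-k]! k≤n) ⟩
  n ! / (k ! * (n ∸ k) !) * (k ! * (n ∸ k) !)  ≡⟨ m/n*n≡m (k![n∸k]!∣n! k≤n) ⟩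
  n !                                          ∎
  where
  open ≡-Reasoning
  instance _ = k !* (n ∸ k) !≢0

[m+m]Cm*[m!*m!]≡[m+m]! : ∀ m → ((m + m) C m) * (m ! * m !) ≡ (m + m) !
[m+m]Cm*[m!*m!]≡[m+m]! m =
  subst (λ k → ((m + m) C m) * (m ! * k !) ≡ (m + m) !) (m+n∸n≡m m m) (nCk*[k!*[n∸k]!]≡n! (m≤n+m m m))

module Horner (B : ℕ) where

  horner : (ℕ → ℕ) → ℕ → ℕ
  horner d zero    = 0
  horner d (suc M) = d 0 + B * horner (d ∘ suc) M

  horner-cong : ∀ {d e} M → (∀ i → d i ≡ e i) → horner d M ≡ horner e M
  horner-cong zero    d≗e = refl
  horner-cong (suc M) d≗e = cong₂ (λ x y → x + B * y) (d≗e 0) (horner-cong M (d≗e ∘ suc))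

  horner-zero : ∀ M → horner (λ _ → 0) M ≡ 0
  horner-zero zero    = refl
  horner-zero (suc M) = trans (cong (B *_) (horner-zero M)) (*-zeroʳ B)

  horner-+ : ∀ d e M → horner (λ i → d i + e i) M ≡ horner d M + horner e M
  horner-+ d e zero    = refl
  horner-+ d e (suc M) = begin
    (d 0 + e 0) + B * horner (λ i → d (suc i) + e (suc i)) M
      ≡⟨ cong (λ x → (d 0 + e 0) + B * x) (horner-+ (d ∘ suc) (e ∘ suc) M) ⟩
    (d 0 + e 0) + B * (horner (d ∘ suc) M + horner (e ∘ suc) M)
      ≡⟨ interchange B (d 0) (e 0) (horner (d ∘ suc) M) (horner (e ∘ suc) M) ⟩
    (d 0 + B * horner (d ∘ suc) M) + (e 0 + B * horner (e ∘ suc) M) ∎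
    where
    open ≡-Reasoning
    interchange : ∀ B a b x y → (a + b) + B * (x + y) ≡ (a + B * x) + (b + B * y)
    interchange = solve-∀

  horner-split : ∀ d k M → horner d (k + M) ≡ horner d k + B ^ k * horner (λ i → d (k + i)) M
  horner-split d zero    M = sym (+-identityʳ (horner d M))
  horner-split d (suc k) M = begin
    d 0 + B * horner (d ∘ suc) (k + M)
      ≡⟨ cong (λ x → d 0 + B * x) (horner-split (d ∘ suc) k M) ⟩
    d 0 + B * (horner (d ∘ suc) k + B ^ k * H)
      ≡⟨ distrib B (d 0) (horner (d ∘ suc) k) (B ^ k) H ⟩
    (d 0 + B * horner (d ∘ suc) k) + B * B ^ k * H ∎
    where
    open ≡-Reasoning
    H = horner (λ i → d (suc k + i)) M
    distrib : ∀ B a x y z → a + B * (x + y * z) ≡ (a + B * x) + B * y * z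
    distrib = solve-∀

  horner-< : ∀ d M → (∀ i → d i < B) → horner d M < B ^ M
  horner-< d zero    d<B = s≤s z≤n
  horner-< d (suc M) d<B = begin-strict
    d 0 + B * H   <⟨ +-monoˡ-< (B * H) (d<B 0) ⟩
    B + B * H     ≡⟨ cong (_+ B * H) (*-identityʳ B) ⟨
    B * 1 + B * H ≡⟨ *-distribˡ-+ B 1 H ⟨
    B * suc H     ≤⟨ *-monoʳ-≤ B (horner-< (d ∘ suc) M (d<B ∘ suc)) ⟩
    B * B ^ M     ∎
    where
    open ≤-Reasoning
    H = horner (d ∘ suc) M

  horner-binomial : ∀ N M → N < M → horner (N C_) M ≡ (1 + B) ^ N
  horner-binomial zero    (suc M) _ = trans (cong (λ x → 1 + B * x) (horner-zero M)) (cong suc (*-zeroʳ B))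
  horner-binomial (suc N) (suc M) (s≤s N<M) = begin
    1 + B * horner (λ i → suc N C suc i) M
      ≡⟨ cong (λ x → 1 + B * x) (horner-cong M (nCk+nC[k+1]≡[n+1]C[k+1] N)) ⟨
    1 + B * horner (λ i → N C i + N C suc i) M
      ≡⟨ cong (λ x → 1 + B * x) (horner-+ (N C_) (λ i → N C suc i) M) ⟩
    1 + B * (horner (N C_) M + S)
      ≡⟨ regroup B (horner (N C_) M) S ⟩
    (1 + B * S) + B * horner (N C_) M
      ≡⟨ cong₂ (λ x y → x + B * y) (horner-binomial N (suc M) (m<n⇒m<1+n N<M)) (horner-binomial N M N<M) ⟩
    (1 + B) ^ N + B * (1 + B) ^ N ∎
    where
    open ≡-Reasoning
    S = horner (λ i → N C suc i) M
    regroup : ∀ B h s → 1 + B * (h + s) ≡ (1 + B * s) + B * h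
    regroup = solve-∀

  horner-digit : .{{_ : NonZero B}} → ∀ d k M → (∀ i → d i < B) →
                 (horner d (k + suc M) / B ^ k) {{m^n≢0 B k}} % B ≡ d k
  horner-digit d k M d<B = begin
    horner d (k + suc M) / B ^ k % B  ≡⟨ cong (λ x → x / B ^ k % B) (horner-split d k (suc M)) ⟩
    (low + B ^ k * T) / B ^ k % B     ≡⟨ cong (λ x → (low + x) / B ^ k % B) (*-comm (B ^ k) T) ⟩
    (low + T * B ^ k) / B ^ k % B     ≡⟨ cong (_% B) (+-distrib-/-∣ʳ low {d = B ^ k} (n∣m*n T)) ⟩
    (low / B ^ k + T * B ^ k / B ^ k) % B
      ≡⟨ cong₂ (λ x y → (x + y) % B) (m<n⇒m/n≡0 (horner-< d k d<B)) (m*n/n≡m T (B ^ k)) ⟩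
    (d (k + 0) + B * H) % B           ≡⟨ cong (λ x → (d (k + 0) + x) % B) (*-comm B H) ⟩
    (d (k + 0) + H * B) % B           ≡⟨ [m+kn]%n≡m%n (d (k + 0)) H B ⟩
    d (k + 0) % B                     ≡⟨ m<n⇒m%n≡m (d<B (k + 0)) ⟩
    d (k + 0)                         ≡⟨ cong d (+-identityʳ k) ⟩
    d k                               ∎
    where
    open ≡-Reasoning
    instance _ = m^n≢0 B k
    low = horner d k
    T = horner (λ i → d (k + i)) (suc M)
    H = horner (λ i → d (k + suc i)) M

binomial-digit : ∀ B .{{_ : NonZero B}} N k → 2 ^ N < B →
                 ((1 + B) ^ N / B ^ k) {{m^n≢0 B k}} % B ≡ N C k
binomial-digit B N k 2^N<B = begin
  (1 + B) ^ N / B ^ k % B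
    ≡⟨ cong (λ x → x / B ^ k % B) (horner-binomial N (k + suc N) (m≤n+m (suc N) k)) ⟨
  horner (N C_) (k + suc N) / B ^ k % B
    ≡⟨ horner-digit (N C_) k N (λ i → ≤-<-trans (nCk≤2^n N i) 2^N<B) ⟩
  N C k ∎
  where
  open ≡-Reasoning
  open Horner B
  instance _ = m^n≢0 B k

-- Doubling with a parity bit

[b+k]!≡k!*[b*k+1] : ∀ b k → b < 2 → (b + k) ! ≡ k ! * (b * k + 1)
[b+k]!≡k!*[b*k+1] 0             k _ = sym (*-identityʳ (k !))
[b+k]!≡k!*[b*k+1] 1             k _ =
  trans (*-comm (suc k) (k !)) (cong (k ! *_) (trans (cong suc (sym (*-identityˡ k))) (+-comm 1 (1 * k))))
[b+k]!≡k!*[b*k+1] (suc (suc _)) k (s≤s (s≤s ()))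

a^[b+k]≡a^k*[b*pred[a]+1] : ∀ a .{{_ : NonZero a}} b k → b < 2 → a ^ (b + k) ≡ a ^ k * (b * pred a + 1)
a^[b+k]≡a^k*[b*pred[a]+1] a       0             k _ = sym (*-identityʳ (a ^ k))
a^[b+k]≡a^k*[b*pred[a]+1] (suc a) 1             k _ =
  trans (*-comm (suc a) (suc a ^ k)) (cong (suc a ^ k *_) (trans (cong suc (sym (*-identityˡ a))) (+-comm 1 (1 * a))))
a^[b+k]≡a^k*[b*pred[a]+1] a       (suc (suc _)) k (s≤s (s≤s ()))

m%2+[m/2+m/2]≡m : ∀ m → m % 2 + (m / 2 + m / 2) ≡ m
m%2+[m/2+m/2]≡m m = sym (trans (m≡m%n+[m/n]*n m 2)
  (cong (_+_ (m % 2)) (trans (*-comm (m / 2) 2) (cong (_+_ (m / 2)) (+-identityʳ (m / 2))))))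

2^[1+j]/2≡2^j : ∀ j → 2 ^ suc j / 2 ≡ 2 ^ j
2^[1+j]/2≡2^j j = trans (/-congˡ (*-comm 2 (2 ^ j))) (m*n/n≡m (2 ^ j) 2)

n/2^[1+j]≡n/2^j/2 : ∀ n j → (n / 2 ^ suc j) {{m^n≢0 2 (suc j)}} ≡ (n / 2 ^ j) {{m^n≢0 2 j}} / 2
n/2^[1+j]≡n/2^j/2 n j = begin
  n / 2 ^ suc j   ≡⟨ /-congʳ (*-comm 2 (2 ^ j)) ⟩
  n / (2 ^ j * 2) ≡⟨ m/n/o≡m/[n*o] n (2 ^ j) 2 ⟨
  n / 2 ^ j / 2   ∎
  where
  open ≡-Reasoning
  instance
    _ = m^n≢0 2 j
    _ = m^n≢0 2 (suc j)
    _ = m*n≢0 (2 ^ j) 2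

2^2^i*2^2^i≡2^2^[1+i] : ∀ i → 2 ^ 2 ^ i * 2 ^ 2 ^ i ≡ 2 ^ 2 ^ suc i
2^2^i*2^2^i≡2^2^[1+i] i =
  trans (sym (^-distribˡ-+-* 2 (2 ^ i) (2 ^ i))) (cong (λ e → 2 ^ (2 ^ i + e)) (sym (+-identityʳ (2 ^ i))))

2^i≤n⇒i<bitLen : ∀ {i n} → 2 ^ i ≤ n → i < bitLen n
2^i≤n⇒i<bitLen {i} 2^i≤n = s≤s (subst (_≤ _) (⌊log₂[2^n]⌋≡n i) (⌊log₂⌋-mono-≤ 2^i≤n))

-- Natural numbers inside ℚ

ℕ→ℚ : ℕ → ℚ
ℕ→ℚ n = ℤ→ℚ (+ n)

ℕ→ℚ≡mkℚ : ∀ n → ℕ→ℚ n ≡ mkℚ (+ n) 0 (coprime-sym (1-coprimeTo n))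
ℕ→ℚ≡mkℚ n = ℚ.normalize-coprime (coprime-sym (1-coprimeTo n))

ℕ→ℚ-+ : ∀ a b → ℕ→ℚ a ℚ.+ ℕ→ℚ b ≡ ℕ→ℚ (a + b)
ℕ→ℚ-+ a b rewrite ℕ→ℚ≡mkℚ a | ℕ→ℚ≡mkℚ b =
  ℚ./-cong (trans (cong₂ ℤ._+_ (ℤ.*-identityʳ (+ a)) (ℤ.*-identityʳ (+ b))) (sym (ℤ.pos-+ a b))) refl

ℕ→ℚ-* : ∀ a b → ℕ→ℚ a ℚ.* ℕ→ℚ b ≡ ℕ→ℚ (a * b)
ℕ→ℚ-* a b rewrite ℕ→ℚ≡mkℚ a | ℕ→ℚ≡mkℚ b = ℚ./-cong (sym (ℤ.pos-* a b)) refl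

ℕ→ℚ-difference : ∀ {a b c} → c + b ≡ a → ℕ→ℚ a ℚ.- ℕ→ℚ b ≡ ℕ→ℚ c
ℕ→ℚ-difference {b = b} {c} refl = begin
  ℕ→ℚ (c + b) ℚ.- ℕ→ℚ b        ≡⟨ cong (ℚ._- ℕ→ℚ b) (ℕ→ℚ-+ c b) ⟨
  (ℕ→ℚ c ℚ.+ ℕ→ℚ b) ℚ.- ℕ→ℚ b  ≡⟨ ℚ.+-assoc (ℕ→ℚ c) (ℕ→ℚ b) (ℚ.- ℕ→ℚ b) ⟩
  ℕ→ℚ c ℚ.+ (ℕ→ℚ b ℚ.- ℕ→ℚ b)  ≡⟨ cong (ℕ→ℚ c ℚ.+_) (ℚ.+-inverseʳ (ℕ→ℚ b)) ⟩
  ℕ→ℚ c ℚ.+ 0ℚ                 ≡⟨ ℚ.+-identityʳ (ℕ→ℚ c) ⟩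
  ℕ→ℚ c                        ∎
  where open ≡-Reasoning

ℕ→ℚ-≤ᵇ-0 : ∀ n → (ℕ→ℚ n ℚ.≤ᵇ 0ℚ) ≡ (n ≤ᵇ 0)
ℕ→ℚ-≤ᵇ-0 zero    = refl
ℕ→ℚ-≤ᵇ-0 (suc n) rewrite ℕ→ℚ≡mkℚ (suc n) = refl

ℕ→ℚ-≢0 : ∀ n .{{_ : NonZero n}} → ℕ→ℚ n ≢ 0ℚ
ℕ→ℚ-≢0 (suc n) n≡0 with () ← ℚ.p≡0⇒↥p≡0 _ (trans (sym (ℕ→ℚ≡mkℚ (suc n))) n≡0)

floor-normalize : ∀ a d .{{_ : NonZero d}} → floor (normalize a d) ≡ + (a / d)
floor-normalize a d = trans (floor-mkℚ+ (a / g) (d / g)) (cong +_ (sym a/d≡[a/g]/[d/g]))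
  where
  g = gcd a d
  instance
    g≢0 : NonZero g
    g≢0 = ≢-nonZero (gcd[m,n]≢0 a d (inj₂ (≢-nonZero⁻¹ d)))
    d/g≢0 : NonZero (d / g)
    d/g≢0 = ≢-nonZero (n/gcd[m,n]≢0 a d {{gcd≢0 = g≢0}})
    d/g*g≢0 : NonZero ((d / g) * g)
    d/g*g≢0 = m*n≢0 (d / g) g
  floor-mkℚ+ : ∀ n d .{{_ : NonZero d}} .{c : Coprime n d} → floor (ℚ.mkℚ+ n d c) ≡ + (n / d)
  floor-mkℚ+ n (suc d) = ℤ.*-identityˡ (+ (n / suc d))
  a/d≡[a/g]/[d/g] : a / d ≡ (a / g) / (d / g)
  a/d≡[a/g]/[d/g] = begin
    a / d                         ≡⟨ /-congˡ (m/n*n≡m (gcd[m,n]∣m a d)) ⟨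
    ((a / g) * g) / d             ≡⟨ /-congʳ (m/n*n≡m (gcd[m,n]∣n a d)) ⟨
    ((a / g) * g) / ((d / g) * g) ≡⟨ m*n/o*n≡m/o (a / g) g (d / g) ⟩
    (a / g) / (d / g)             ∎
    where open ≡-Reasoning

floor-÷ : ∀ a d .{{_ : NonZero d}} {x y} .{{_ : ℚ.NonZero y}} →
          x ≡ ℕ→ℚ a → y ≡ ℕ→ℚ d → floor (x ℚ.÷ y) ≡ + (a / d)
floor-÷ a (suc d) refl refl rewrite ℕ→ℚ≡mkℚ a | ℕ→ℚ≡mkℚ (suc d) =
  trans (cong floor (ℚ./-cong (ℤ.*-identityʳ (+ a)) (*-identityˡ (suc d)))) (floor-normalize a (suc d))

-- Running programs

record Runs (wb : ℕ) (P : Program) (t : ℕ) (c c′ : Config) : Set where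
  constructor runs
  field run≡just : run wb P t c ≡ just c′

run-+ : ∀ wb P a b c → run wb P (a + b) c ≡ (run wb P a c >>= run wb P b)
run-+ wb P zero    b c = refl
run-+ wb P (suc a) b c with step wb P c
... | nothing = refl
... | just c₁ = run-+ wb P a b c₁

infixr 5 _⊕_

_⊕_ : ∀ {wb P a b c₀ c₁ c₂} → Runs wb P a c₀ c₁ → Runs wb P b c₁ c₂ → Runs wb P (a + b) c₀ c₂
_⊕_ {wb} {P} {a} {b} {c₀} (runs r₁) (runs r₂) =
  runs (trans (run-+ wb P a b c₀) (trans (cong (_>>= run wb P b) r₁) r₂))

executes : ∀ {wb P ins c c′} → fetch P (pc c) ≡ just ins → exec wb ins c ≡ just c′ → Runs wb P 1 c c′
executes {wb} {P} {c = c} fetched executed = runs (trans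
  (cong (λ i → (i >>= λ ins → exec wb ins c) >>= run wb P 0) fetched)
  (cong (_>>= run wb P 0) executed))

update-same : ∀ {A : Set} (f : ℕ → A) i a → update f i a i ≡ a
update-same f i a with i ≟ i
... | yes _   = refl
... | no i≢i = contradiction refl i≢i

rcopy-runs : ∀ {wb P p w r i j} → fetch P p ≡ just (rcopy i j) →
             Runs wb P 1 (cfg p w r) (cfg (suc p) w (update r i (r j)))
rcopy-runs fetched = executes fetched refl

jmp-runs : ∀ {wb P p w r l} → fetch P p ≡ just (jmp l) → Runs wb P 1 (cfg p w r) (cfg l w r)
jmp-runs fetched = executes fetched refl

rjpos-jumps : ∀ {wb P p w r i l} x → fetch P p ≡ just (rjpos i l) → r i ≡ ℕ→ℚ x → 0 < x →
              Runs wb P 1 (cfg p w r) (cfg l w r)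
rjpos-jumps {p = p} {w} {r} (suc x) fetched rᵢ _ =
  executes fetched (cong (λ b → just (cfg (if b then suc p else _) w r))
                         (trans (cong (ℚ._≤ᵇ 0ℚ) rᵢ) (ℕ→ℚ-≤ᵇ-0 (suc x))))

rjpos-falls : ∀ {wb P p w r i l} → fetch P p ≡ just (rjpos i l) → r i ≡ ℕ→ℚ 0 →
              Runs wb P 1 (cfg p w r) (cfg (suc p) w r)
rjpos-falls {p = p} {w} {r} fetched rᵢ =
  executes fetched (cong (λ b → just (cfg (if b then suc p else _) w r)) (cong (ℚ._≤ᵇ 0ℚ) rᵢ))

rop-runs : ∀ {wb P p w r o i j k} a b {v} → fetch P p ≡ just (rop o i j k) →
           r j ≡ ℕ→ℚ a → r k ≡ ℕ→ℚ b → evalR o (ℕ→ℚ a) (ℕ→ℚ b) ≡ just (ℕ→ℚ v) →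
           Runs wb P 1 (cfg p w r) (cfg (suc p) w (update r i (ℕ→ℚ v)))
rop-runs {p = p} {w} {r} {o} {i} a b fetched rⱼ rₖ evaluated =
  executes fetched (trans (cong₂ (λ x y → evalR o x y >>= continue) rⱼ rₖ) (cong (_>>= continue) evaluated))
  where
  continue : ℚ → Maybe Config
  continue v = just (cfg (suc p) w (update r i v))

radd-runs : ∀ {wb P p w r i j k} a b → fetch P p ≡ just (rop radd i j k) → r j ≡ ℕ→ℚ a → r k ≡ ℕ→ℚ b →
            Runs wb P 1 (cfg p w r) (cfg (suc p) w (update r i (ℕ→ℚ (a + b))))
radd-runs a b fetched rⱼ rₖ = rop-runs a b {a + b} fetched rⱼ rₖ (cong just (ℕ→ℚ-+ a b))

rmul-runs : ∀ {wb P p w r i j k} a b → fetch P p ≡ just (rop rmul i j k) → r j ≡ ℕ→ℚ a → r k ≡ ℕ→ℚ b →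
            Runs wb P 1 (cfg p w r) (cfg (suc p) w (update r i (ℕ→ℚ (a * b))))
rmul-runs a b fetched rⱼ rₖ = rop-runs a b {a * b} fetched rⱼ rₖ (cong just (ℕ→ℚ-* a b))

rsub-runs : ∀ {wb P p w r i j k} a b {c} → fetch P p ≡ just (rop rsub i j k) → r j ≡ ℕ→ℚ a → r k ≡ ℕ→ℚ b →
            c + b ≡ a → Runs wb P 1 (cfg p w r) (cfg (suc p) w (update r i (ℕ→ℚ c)))
rsub-runs a b {c} fetched rⱼ rₖ c+b≡a =
  rop-runs a b {c} fetched rⱼ rₖ (cong just (ℕ→ℚ-difference {a} {b} {c} c+b≡a))

-- The value rdiv stores (junk 0ℚ for a zero divisor, where the machine gets stuck instead).
-- Opaque because it is always overwritten by the next rfloor, while unfolding exact rational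
-- division inside the long symbolic runs below exhausts the type checker's memory.
opaque
  rdiv-result : ℚ → ℚ → ℚ
  rdiv-result a b with b ℚ.≟ 0ℚ
  ... | yes _   = 0ℚ
  ... | no b≢0 = (a ℚ.÷ b) {{ℚ.≢-nonZero b≢0}}

  evalR-rdiv : ∀ a b → b ≢ 0ℚ → evalR rdiv a b ≡ just (rdiv-result a b)
  evalR-rdiv a b b≢0 with b ℚ.≟ 0ℚ
  ... | yes b≡0 = contradiction b≡0 b≢0
  ... | no _    = refl

  floor-rdiv-result : ∀ a d .{{_ : NonZero d}} {x y} → x ≡ ℕ→ℚ a → y ≡ ℕ→ℚ d → floor (rdiv-result x y) ≡ + (a / d)
  floor-rdiv-result a d {y = y} x≡a y≡d with y ℚ.≟ 0ℚ
  ... | yes y≡0 = contradiction (trans (sym y≡d) y≡0) (ℕ→ℚ-≢0 d)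
  ... | no y≢0  = floor-÷ a d {{_}} {{ℚ.≢-nonZero y≢0}} x≡a y≡d

rdiv-runs : ∀ {wb P p w r i j k} → r k ≢ 0ℚ → fetch P p ≡ just (rop rdiv i j k) →
            Runs wb P 1 (cfg p w r) (cfg (suc p) w (update r i (rdiv-result (r j) (r k))))
rdiv-runs {r = r} {j = j} {k} rₖ≢0 fetched = executes fetched (cong (_>>= _) (evalR-rdiv (r j) (r k) rₖ≢0))

rfloor-runs : ∀ {wb P p w r i j} → fetch P p ≡ just (rfloor i j) →
              Runs wb P 1 (cfg p w r) (cfg (suc p) w (update r i (ℤ→ℚ (floor (r j)))))
rfloor-runs fetched = executes fetched refl

rdiv-rfloor-runs : ∀ {wb P p w r i j k} a d .{{_ : NonZero d}} →
                   fetch P p ≡ just (rop rdiv i j k) → fetch P (suc p) ≡ just (rfloor i i) →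
                   r j ≡ ℕ→ℚ a → r k ≡ ℕ→ℚ d →
                   Runs wb P 2 (cfg p w r)
                               (cfg (2 + p) w (update (update r i (rdiv-result (r j) (r k))) i (ℕ→ℚ (a / d))))
rdiv-rfloor-runs {wb} {P} {p} {w} {r} {i} {j} {k} a d fetched₁ fetched₂ rⱼ rₖ =
  rdiv-runs (ℕ→ℚ-≢0 d ∘ trans (sym rₖ)) fetched₁ ⊕
  subst (λ x → Runs wb P 1 (cfg (suc p) w r′) (cfg (2 + p) w (update r′ i (ℤ→ℚ x)))) floor≡ (rfloor-runs fetched₂)
  where
  r′ = update r i (rdiv-result (r j) (r k))
  floor≡ : floor (r′ i) ≡ + (a / d)
  floor≡ = trans (cong floor (update-same r i _)) (floor-rdiv-result a d rⱼ rₖ)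

-- From pc 8: while ⌊ n / P ⌋ > 0, double P
-- and square B.  From pc 15: while ⌊ P / 2 ⌋ > 0, halve P, set m′ = ⌊ n / P ⌋ and bit = m′ - 2 m,
-- and move m !, (1 + B) ^ m and B ^ m to m′, multiplying by bit * x + 1 instead of branching on
-- the bit.  At pc 46, output m !.
factorialProgram : Program
factorialProgram =
  rconst 1 (+ 1) ∷ rconst 2 (+ 2) ∷ rconst 3 (+ 0) ∷ rconst 4 (+ 1) ∷
  rconst 5 (+ 1) ∷ rconst 6 (+ 1) ∷ rconst 10 (+ 1) ∷ rconst 11 (+ 2) ∷
  rop rdiv 7 0 1 ∷ rfloor 7 7 ∷ rjpos 7 12 ∷ jmp 15 ∷
  rop rmul 1 1 11 ∷ rop rmul 2 2 2 ∷ jmp 8 ∷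
  rop rdiv 7 1 11 ∷ rfloor 7 7 ∷ rjpos 7 19 ∷ jmp 46 ∷
  rcopy 1 7 ∷ rop rdiv 8 0 1 ∷ rfloor 8 8 ∷ rop radd 9 3 3 ∷ rop rsub 15 8 9 ∷
  rop rmul 12 5 5 ∷ rop rdiv 13 12 6 ∷ rfloor 13 13 ∷ rop rdiv 14 13 2 ∷ rfloor 14 14 ∷
  rop rmul 14 14 2 ∷ rop rsub 13 13 14 ∷
  rop rmul 4 4 4 ∷ rop rmul 4 13 4 ∷ rop rmul 14 15 9 ∷ rop radd 14 14 10 ∷ rop rmul 4 4 14 ∷
  rop rmul 14 15 2 ∷ rop radd 14 14 10 ∷ rop rmul 5 12 14 ∷
  rop rsub 14 2 10 ∷ rop rmul 14 15 14 ∷ rop radd 14 14 10 ∷ rop rmul 6 6 6 ∷ rop rmul 6 6 14 ∷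
  rcopy 3 8 ∷ jmp 15 ∷
  rcopy 0 4 ∷ halt ∷ []

record Invariant (r : ℕ → ℚ) (n P B m : ℕ) : Set where
  field
    input     : r 0  ≡ ℕ→ℚ n
    power     : r 1  ≡ ℕ→ℚ P
    base      : r 2  ≡ ℕ→ℚ B
    quotient  : r 3  ≡ ℕ→ℚ m
    factorial : r 4  ≡ ℕ→ℚ (m !)
    binomials : r 5  ≡ ℕ→ℚ ((1 + B) ^ m)
    shifter   : r 6  ≡ ℕ→ℚ (B ^ m)
    one       : r 10 ≡ ℕ→ℚ 1
    two       : r 11 ≡ ℕ→ℚ 2
open Invariant

module Execution (wb n : ℕ) where

  w : ℕ → ℤ
  w = W (initConfig n)

  Squaring : (ℕ → ℚ) → ℕ → Set
  Squaring r i = Invariant r n (2 ^ i) (2 ^ 2 ^ i) 0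

  initialisation : ∃[ r ] Runs wb factorialProgram 8 (initConfig n) (cfg 8 w r) × Squaring r 0
  initialisation = _ , runs refl ,
    record { input = refl ; power = refl ; base = refl ; quotient = refl ; factorial = refl
           ; binomials = refl ; shifter = refl ; one = refl ; two = refl }

  squaring-continues : ∀ {r} i → 2 ^ i ≤ n → Squaring r i →
    ∃[ r′ ] Runs wb factorialProgram 6 (cfg 8 w r) (cfg 8 w r′) × Squaring r′ (suc i)
  squaring-continues i 2^i≤n I = _ ,
    rdiv-rfloor-runs n (2 ^ i) refl refl (input I) (power I) ⊕
    rjpos-jumps (n / 2 ^ i) refl refl (m≥n⇒m/n>0 2^i≤n) ⊕
    rmul-runs (2 ^ i) 2 refl (power I) (two I) ⊕
    rmul-runs (2 ^ 2 ^ i) (2 ^ 2 ^ i) refl (base I) (base I) ⊕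
    jmp-runs refl ,
    record { input = input I ; power = cong ℕ→ℚ (*-comm (2 ^ i) 2) ; base = cong ℕ→ℚ (2^2^i*2^2^i≡2^2^[1+i] i)
           ; quotient = quotient I ; factorial = factorial I ; binomials = binomials I ; shifter = shifter I
           ; one = one I ; two = two I }
    where instance _ = m^n≢0 2 i

  squaring-stops : ∀ {r} i → n < 2 ^ i → Squaring r i →
    ∃[ r′ ] Runs wb factorialProgram 4 (cfg 8 w r) (cfg 15 w r′) × Squaring r′ i
  squaring-stops i n<2^i I = _ ,
    rdiv-rfloor-runs n (2 ^ i) refl refl (input I) (power I) ⊕
    rjpos-falls refl (cong ℕ→ℚ (m<n⇒m/n≡0 n<2^i)) ⊕
    jmp-runs refl ,
    record { input = input I ; power = power I ; base = base I
           ; quotient = quotient I ; factorial = factorial I ; binomials = binomials I ; shifter = shifter I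
           ; one = one I ; two = two I }
    where instance _ = m^n≢0 2 i

  SquaringDone : (ℕ → ℚ) → ℕ → Set
  SquaringDone r L = Squaring r L × n < 2 ^ L × L ≤ bitLen n

  -- The fuel k never runs out: another round needs 2 ^ i ≤ n, that is i < bitLen n.
  squaring : ∀ k i {r} → i + k ≡ bitLen n → Squaring r i →
    ∃[ l ] ∃[ r′ ] Runs wb factorialProgram (4 + l * 6) (cfg 8 w r) (cfg 15 w r′) × SquaringDone r′ (i + l)
  squaring k i i+k≡b I with n <? 2 ^ i
  ... | yes n<2^i =
    let r′ , stops , I′ = squaring-stops i n<2^i I
    in 0 , r′ , stops , subst (SquaringDone r′) (sym (+-identityʳ i)) (I′ , n<2^i , subst (i ≤_) i+k≡b (m≤m+n i k))
  ... | no n≮2^i with k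
  ...   | zero  = contradiction (2^i≤n⇒i<bitLen (≮⇒≥ n≮2^i)) (<-irrefl (trans (sym (+-identityʳ i)) i+k≡b))
  ...   | suc k =
    let _ , continues , I₁ = squaring-continues i (≮⇒≥ n≮2^i) I
        l , r′ , rest , done = squaring k (suc i) (trans (sym (+-suc i k)) i+k≡b) I₁
    in suc l , r′ , continues ⊕ rest , subst (SquaringDone r′) (sym (+-suc i l)) done

  module Halving (L : ℕ) (n<2^L : n < 2 ^ L) where

    B : ℕ
    B = 2 ^ 2 ^ L

    instance
      B≢0 : NonZero B
      B≢0 = m^n≢0 2 (2 ^ L)

    Halved : (ℕ → ℚ) → ℕ → Set
    Halved r j = Invariant r n (2 ^ j) B ((n / 2 ^ j) {{m^n≢0 2 j}})

    module Doubling (j : ℕ) where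

      instance
        _ = m^n≢0 2 j
        _ = m^n≢0 2 (suc j)

      m′ m bit : ℕ
      m′ = n / 2 ^ j
      m = n / 2 ^ suc j
      bit = m′ % 2

      X Q u : ℕ
      X = (1 + B) ^ m
      Q = B ^ m
      u = (X * X / Q) {{m^n≢0 B m}}

      parity : bit + (m + m) ≡ m′
      parity = subst (λ h → bit + (h + h) ≡ m′) (sym (n/2^[1+j]≡n/2^j/2 n j)) (m%2+[m/2+m/2]≡m m′)

      bit<2 : bit < 2
      bit<2 = m%n<n m′ 2

      2^[m+m]<B : 2 ^ (m + m) < B
      2^[m+m]<B = ^-monoʳ-< 2 (s≤s (s≤s z≤n)) (≤-<-trans m+m≤n n<2^L)
        where m+m≤n = ≤-trans (subst (m + m ≤_) parity (m≤n+m (m + m) bit)) (m/n≤m n (2 ^ j))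

      central-digit : u % B ≡ (m + m) C m
      central-digit = trans (cong (λ x → (x / Q) {{m^n≢0 B m}} % B) (sym (^-distribˡ-+-* (1 + B) m m)))
                            (binomial-digit B (m + m) m 2^[m+m]<B)

      factorial-doubles : u % B * (m ! * m !) * (bit * (m + m) + 1) ≡ m′ !
      factorial-doubles = begin
        u % B * (m ! * m !) * (bit * (m + m) + 1)         ≡⟨ cong (λ c → c * (m ! * m !) * (bit * (m + m) + 1)) central-digit ⟩
        ((m + m) C m) * (m ! * m !) * (bit * (m + m) + 1) ≡⟨ cong (_* (bit * (m + m) + 1)) ([m+m]Cm*[m!*m!]≡[m+m]! m) ⟩
        (m + m) ! * (bit * (m + m) + 1)                   ≡⟨ [b+k]!≡k!*[b*k+1] bit (m + m) bit<2 ⟨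
        (bit + (m + m)) !                                 ≡⟨ cong _! parity ⟩
        m′ !                                              ∎
        where open ≡-Reasoning

      power-doubles : ∀ a .{{_ : NonZero a}} → a ^ m * a ^ m * (bit * pred a + 1) ≡ a ^ m′
      power-doubles a = begin
        a ^ m * a ^ m * (bit * pred a + 1) ≡⟨ cong (_* (bit * pred a + 1)) (^-distribˡ-+-* a m m) ⟨
        a ^ (m + m) * (bit * pred a + 1)   ≡⟨ a^[b+k]≡a^k*[b*pred[a]+1] a bit (m + m) bit<2 ⟨
        a ^ (bit + (m + m))                ≡⟨ cong (a ^_) parity ⟩
        a ^ m′                             ∎
        where open ≡-Reasoning

    halving-step : ∀ {r} j → Halved r (suc j) →
      ∃[ r′ ] Runs wb factorialProgram 30 (cfg 15 w r) (cfg 15 w r′) × Halved r′ j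
    halving-step j I = _ ,
      rdiv-rfloor-runs (2 ^ suc j) 2 refl refl (power I) (two I) ⊕
      rjpos-jumps (2 ^ suc j / 2) refl refl (subst (0 <_) (sym (2^[1+j]/2≡2^j j)) (m^n>0 2 j)) ⊕
      rcopy-runs refl ⊕
      rdiv-rfloor-runs n (2 ^ j) refl refl (input I) (cong ℕ→ℚ (2^[1+j]/2≡2^j j)) ⊕
      radd-runs m m refl (quotient I) (quotient I) ⊕
      rsub-runs m′ (m + m) {bit} refl refl refl parity ⊕
      rmul-runs X X refl (binomials I) (binomials I) ⊕
      rdiv-rfloor-runs (X * X) Q refl refl refl (shifter I) ⊕
      rdiv-rfloor-runs u B refl refl refl (base I) ⊕
      rmul-runs (u / B) B refl refl (base I) ⊕
      rsub-runs u (u / B * B) {u % B} refl refl refl (sym (m≡m%n+[m/n]*n u B)) ⊕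
      rmul-runs (m !) (m !) refl (factorial I) (factorial I) ⊕
      rmul-runs (u % B) (m ! * m !) refl refl refl ⊕
      rmul-runs bit (m + m) refl refl refl ⊕
      radd-runs (bit * (m + m)) 1 refl refl (one I) ⊕
      rmul-runs (u % B * (m ! * m !)) (bit * (m + m) + 1) refl refl refl ⊕
      rmul-runs bit B refl refl (base I) ⊕
      radd-runs (bit * B) 1 refl refl (one I) ⊕
      rmul-runs (X * X) (bit * B + 1) refl refl refl ⊕
      rsub-runs B 1 {pred B} refl (base I) (one I) (trans (+-comm (pred B) 1) (suc-pred B)) ⊕
      rmul-runs bit (pred B) refl refl refl ⊕
      radd-runs (bit * pred B) 1 refl refl (one I) ⊕
      rmul-runs Q Q refl (shifter I) (shifter I) ⊕
      rmul-runs (Q * Q) (bit * pred B + 1) refl refl refl ⊕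
      rcopy-runs refl ⊕
      jmp-runs refl ,
      record { input = input I ; power = cong ℕ→ℚ (2^[1+j]/2≡2^j j) ; base = base I ; quotient = refl
             ; factorial = cong ℕ→ℚ factorial-doubles
             ; binomials = cong ℕ→ℚ (power-doubles (1 + B)) ; shifter = cong ℕ→ℚ (power-doubles B)
             ; one = one I ; two = two I }
      where
      open Doubling j
      instance
        _ = m^n≢0 2 j
        _ = m^n≢0 B m

    halving-stops : ∀ {r} → Halved r 0 →
      ∃[ r′ ] Runs wb factorialProgram 5 (cfg 15 w r) (cfg 47 w r′) × r′ 0 ≡ ℕ→ℚ (n !)
    halving-stops I = _ ,
      rdiv-rfloor-runs 1 2 refl refl (power I) (two I) ⊕
      rjpos-falls refl refl ⊕
      jmp-runs refl ⊕
      rcopy-runs refl ,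
      trans (factorial I) (cong (λ x → ℕ→ℚ (x !)) (n/1≡n n))

    halving : ∀ j {r} → Halved r j →
      ∃[ r′ ] Runs wb factorialProgram (5 + j * 30) (cfg 15 w r) (cfg 47 w r′) × r′ 0 ≡ ℕ→ℚ (n !)
    halving zero    I = halving-stops I
    halving (suc j) I =
      let _ , step , I₁ = halving-step j I
          r′ , rest , output = halving j I₁
      in r′ , step ⊕ rest , output

  computes-factorial : ∃[ L ] L ≤ bitLen n ×
    HaltsWithOutput wb factorialProgram (initConfig n) (8 + ((4 + L * 6) + (5 + L * 30))) (ℕ→ℚ (n !))
  computes-factorial =
    let _ , initialises , I₀ = initialisation
        L , r₁ , squarings , I₁ , n<2^L , L≤b = squaring (bitLen n) 0 refl I₀
        I₁′ = subst (Invariant r₁ n (2 ^ L) (2 ^ 2 ^ L)) (sym (m<n⇒m/n≡0 {{m^n≢0 2 L}} n<2^L)) I₁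
        r′ , halvings , output = Halving.halving L n<2^L L I₁′
    in L , L≤b , cfg 47 w r′ , Runs.run≡just (initialises ⊕ squarings ⊕ halvings) , refl , output

running-time≤ : ∀ {L} b .{{_ : NonZero b}} → L ≤ b → 8 + ((4 + L * 6) + (5 + L * 30)) ≤ 53 * (b * b)
running-time≤ {L} b L≤b = begin
  8 + ((4 + L * 6) + (5 + L * 30)) ≡⟨ collect L ⟩
  17 + L * 36                      ≤⟨ +-monoʳ-≤ 17 (*-monoˡ-≤ 36 L≤b) ⟩
  17 + b * 36                      ≤⟨ +-monoˡ-≤ (b * 36) (m≤m*n 17 b) ⟩
  17 * b + b * 36                  ≡⟨ collect′ b ⟩
  53 * b                           ≤⟨ *-monoʳ-≤ 53 (m≤m*n b b) ⟩
  53 * (b * b)                     ∎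
  where
  open ≤-Reasoning
  collect : ∀ L → 8 + ((4 + L * 6) + (5 + L * 30)) ≡ 17 + L * 36
  collect = solve-∀
  collect′ : ∀ b → 17 * b + b * 36 ≡ 53 * b
  collect′ = solve-∀

-- The program never touches a word register, so it runs with any word size; k = 0 will do.
mainTheorem2 : ∃[ k ] ∃[ P ] ∃[ C ] ∀ (n : ℕ) →
                 ∃[ t ] (t ≤ C * (bitLen n * bitLen n))
                   × HaltsWithOutput (wordBits k (bitLen n)) P (initConfig n) t (ℤ→ℚ (+ (n !)))
mainTheorem2 = 0 , factorialProgram , 53 , λ n →
  let L , L≤b , halts = Execution.computes-factorial (wordBits 0 (bitLen n)) n
  in _ , running-time≤ (bitLen n) L≤b , halts
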